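{- Let $s\ge1$, $t\ge 2$, $G\in\mathcal{G}_{s,t}$ with root $r$, and let $C$ be a non-trivial configuration with $k$ pebble-free vertices in $S$. If $k$ is even and $C_T\le k+1$, then Defender has a winning strategy.
   Context: A configuration $C$ on a graph $G$ is a function $C:V(G)\to\mathbb{Z}_{\ge 0}$. A pebbling move removes two pebbles from a vertex and places one pebble on an adjacent vertex. The Two-Player Pebbling Game on $G$ with root $r$ and starting configuration $C$ is played by Mover and Defender in rounds: in each round Mover makes a pebbling move and then Defender makes a pebbling move; each player must take their turn. If Mover pebbles from $u$ to $v$, Defender may not pebble from $v$ to $u$ in the same round. Mover wins if at any time the root has at least one pebble; Defender wins if the root has no pebble and there are no more pebbling moves. A winning strategy is a rule choosing a player's moves as a function of the current position which guarantees that player wins. For integers $s,t\ge1$, $\mathcal{G}_{s,t}$ is the class of all graphs $(K_1\cup \overline{K_t})\vee H$, where $H$ is any graph on $s$ vertices, $\overline{K_t}$ is the edgeless graph on $t$ vertices, $\cup$ is disjoint union and $\vee$ is the join. The root $r$ is the vertex of $K_1$; $S=V(H)$, $T=V(\overline{K_t})$. A configuration is non-trivial if each vertex of $S$ has 0 or 1 pebbles and the root has no pebbles. A vertex is pebble-free if it has no pebbles. $k$ is the number of pebble-free vertices of $S$, and $C_T=\sum_{v\in T}\lfloor C(v)/2\rfloor$. -}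

module Defs where

open import Data.Nat using (ℕ; zero; suc; _+_; _≤_; _/_; _≟_)
open import Data.Fin using (Fin)
open import Data.List using (List; length; filter; map; allFin)
open import Data.Nat.ListAction using (sum)
open import Data.Product using (Σ; ∃; _×_; _,_)
open import Relation.Binary.PropositionalEquality using (_≡_; _≢_)
open import Relation.Nullary using (¬_)
open import Level using (0ℓ)

record SimpleGraph (s : ℕ) : Set₁ where
  field
    Adj     : Fin s → Fin s → Set
    sym     : ∀ {i j} → Adj i j → Adj j i
    irrefl  : ∀ {i} → ¬ Adj i i

-- Vertices of (K₁ ∪ K̄_t) ∨ H :  the root r, the vertices of S = V(H), the vertices of T.
data V (s t : ℕ) : Set where
  root : V s t
  sv   : Fin s → V s t
  tv   : Fin t → V s t

data Edge {s t : ℕ} (H : SimpleGraph s) : V s t → V s t → Set where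
  r-S : ∀ i → Edge H root (sv i)
  S-r : ∀ i → Edge H (sv i) root
  T-S : ∀ j i → Edge H (tv j) (sv i)
  S-T : ∀ i j → Edge H (sv i) (tv j)
  S-S : ∀ {i i'} → SimpleGraph.Adj H i i' → Edge H (sv i) (sv i')

Config : ℕ → ℕ → Set
Config s t = V s t → ℕ

Legal : ∀ {s t} (H : SimpleGraph s) → Config s t → V s t → V s t → Set
Legal H C u v = Edge H u v × 2 ≤ C u

Result : ∀ {s t} → Config s t → V s t → V s t → Config s t → Set
Result C u v C' =
  (C' u + 2 ≡ C u) × (C' v ≡ suc (C v)) × (∀ w → w ≢ u → w ≢ v → C' w ≡ C w)

-- Game positions (root always pebble-free; otherwise Mover has already won).
-- DefWinsM H C : Mover is to move in C, and Defender can force a win.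
-- DefWinsD H C u v : Mover just pebbled from u to v producing C, Defender is
--   to move (and may not pebble from v to u), and Defender can force a win.
-- The game ends when the player to move has no legal move; Mover wins iff the
-- root ever holds a pebble.
mutual
  data DefWinsM {s t : ℕ} (H : SimpleGraph s) (C : Config s t) : Set where
    mover-turn :
      (∀ u v → Legal H C u v → ∀ C' → Result C u v C' →
         (C' root ≡ 0) × DefWinsD H C' u v) →
      DefWinsM H C

  data DefWinsD {s t : ℕ} (H : SimpleGraph s) (C : Config s t) (mu mv : V s t) : Set where
    defender-stuck :
      (∀ u v → Legal H C u v → (u ≡ mv × v ≡ mu)) →
      DefWinsD H C mu mv
    defender-move : ∀ u v C' →
      Legal H C u v → ¬ (u ≡ mv × v ≡ mu) → Result C u v C' →
      C' root ≡ 0 → DefWinsM H C' →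
      DefWinsD H C mu mv

DefenderWins : ∀ {s t} → SimpleGraph s → Config s t → Set
DefenderWins H C = DefWinsM H C

NonTrivial : ∀ {s t} → Config s t → Set
NonTrivial {s} C = (C root ≡ 0) × (∀ (i : Fin s) → C (sv i) ≤ 1)

pebbleFreeS : ∀ {s t} → Config s t → ℕ
pebbleFreeS {s} C = length (filter (λ i → C (sv i) ≟ 0) (allFin s))

CT : ∀ {s t} → Config s t → ℕ
CT {t = t} C = sum (map (λ j → C (tv j) / 2) (allFin t))

module Submission where

-- Call a position safe if the root is empty, every S-vertex holds
-- at most one pebble, and  C_T + (k mod 2) ≤ k + 1.  In a safe position the
-- only legal moves go from T to S, so Mover pebbles some tv j → sv i.
--   * If sv i was empty, C_T and k both drop by one.  If a T-vertex can still
--     move, the bound guarantees another empty S-vertex and Defender fills it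
--     (C_T and k drop by one more); otherwise Defender cannot move and wins.
--   * If sv i held a pebble, it now holds two and Defender pebbles it onto a
--     T-vertex other than tv j; k rises by one and C_T does not grow.
-- Either way the position is safe again, and the number of pebbles on T has
-- strictly decreased, which bounds the length of the game.

open import Defs
open import Data.Nat using (ℕ; _+_; _≤_)
open import Data.Nat.Divisibility using (_∣_)

open import Data.Nat using (zero; suc; _*_; _∸_; _<_; _/_; _%_; z≤n; s≤s; _≟_; _≤?_)
open import Data.Nat.Properties
open import Data.Nat.DivMod using (m/n≡1+[m∸n]/n; /-monoˡ-≤; m%n<n; m*n%n≡0)
open import Data.Nat.Divisibility using (divides)
open import Data.Nat.ListAction using (sum)
open import Algebra.Properties.CommutativeMonoid.Sum +-0-commutativeMonoid using (sum-remove; sum-cong-≗) renaming (sum to ∑)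
open import Data.Fin using (Fin; punchIn)
open import Data.Fin.Properties using (any?; punchInᵢ≢i) renaming (_≟_ to _≟F_)
open import Data.List using (List; []; _∷_; length; filter; map; allFin; tabulate)
open import Data.List.Properties using (map-tabulate)
open import Data.Maybe using (Maybe; nothing; just)
import Data.Maybe.Properties as Maybe
open import Data.Sum using (_⊎_; inj₁; inj₂)
import Data.Sum.Properties as Sum
open import Data.Product using (∃; ∃₂; _×_; _,_; proj₁; proj₂)
open import Data.Empty using (⊥-elim)
open import Function using (id; _∘_)
open import Relation.Nullary using (¬_; Dec; yes; no; contradiction)
open import Relation.Nullary.Decidable using (map′)
open import Relation.Binary.PropositionalEquality

sum-split : ∀ {n} (f g : Fin n → ℕ) (j : Fin n) → (∀ i → i ≢ j → f i ≡ g i) →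
  ∃ λ rest → (∑ f ≡ f j + rest) × (∑ g ≡ g j + rest)
sum-split {suc n} f g j agree =
  ∑ (f ∘ punchIn j) , sum-remove {i = j} f ,
  trans (sum-remove {i = j} g)
        (cong (g j +_) (sum-cong-≗ λ k → sym (agree (punchIn j k) (punchInᵢ≢i j k))))

sum-raiseAt : ∀ {n} (f g : Fin n → ℕ) (j : Fin n) → (∀ i → i ≢ j → f i ≡ g i) →
  ∀ d → g j ≡ d + f j → ∑ g ≡ d + ∑ f
sum-raiseAt f g j agree d raised with sum-split f g j agree
... | rest , ∑f , ∑g = begin
  ∑ g               ≡⟨ ∑g ⟩
  g j + rest        ≡⟨ cong (_+ rest) raised ⟩
  (d + f j) + rest  ≡⟨ +-assoc d (f j) rest ⟩
  d + (f j + rest)  ≡⟨ cong (d +_) (sym ∑f) ⟩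
  d + ∑ f           ∎
  where open ≡-Reasoning

sum-boundAt : ∀ {n} (f g : Fin n → ℕ) (j : Fin n) → (∀ i → i ≢ j → f i ≡ g i) →
  ∀ d → g j ≤ d + f j → ∑ g ≤ d + ∑ f
sum-boundAt f g j agree d bounded with sum-split f g j agree
... | rest , ∑f , ∑g = begin
  ∑ g               ≡⟨ ∑g ⟩
  g j + rest        ≤⟨ +-monoˡ-≤ rest bounded ⟩
  (d + f j) + rest  ≡⟨ +-assoc d (f j) rest ⟩
  d + (f j + rest)  ≡⟨ cong (d +_) (sym ∑f) ⟩
  d + ∑ f           ∎
  where open ≤-Reasoning

term≤sum : ∀ {n} (f : Fin n → ℕ) (j : Fin n) → f j ≤ ∑ f
term≤sum {suc n} f j = subst (f j ≤_) (sym (sum-remove {i = j} f)) (m≤m+n (f j) _)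

isZero : ℕ → ℕ
isZero zero    = 1
isZero (suc _) = 0

zero-of-count : ∀ {n} (g : Fin n → ℕ) → 1 ≤ ∑ (λ i → isZero (g i)) → ∃ λ i → g i ≡ 0
zero-of-count {zero}  g ()
zero-of-count {suc n} g positive with g Fin.zero in eq
... | zero  = Fin.zero , eq
... | suc _ with zero-of-count (g ∘ Fin.suc) positive
...   | i , gi≡0 = Fin.suc i , gi≡0

sum-allFin : ∀ {n} (f : Fin n → ℕ) → sum (map f (allFin n)) ≡ ∑ f
sum-allFin f = trans (cong sum (map-tabulate id f)) (sum-tabulate f)
  where
  sum-tabulate : ∀ {n} (f : Fin n → ℕ) → sum (tabulate f) ≡ ∑ f
  sum-tabulate {zero}  f = refl
  sum-tabulate {suc n} f = cong (f Fin.zero +_) (sum-tabulate (f ∘ Fin.suc))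

count-zeros : ∀ {A : Set} (g : A → ℕ) (xs : List A) →
  length (filter (λ x → g x ≟ 0) xs) ≡ sum (map (λ x → isZero (g x)) xs)
count-zeros g [] = refl
count-zeros g (x ∷ xs) with g x
... | zero  = cong suc (count-zeros g xs)
... | suc _ = count-zeros g xs

module _ {s t : ℕ} where

  tPebbles : Config s t → ℕ
  tPebbles C = ∑ λ j → C (tv j)

  capT : Config s t → ℕ
  capT C = ∑ λ j → C (tv j) / 2

  freeS : Config s t → ℕ
  freeS C = ∑ λ i → isZero (C (sv i))

  CT≡capT : (C : Config s t) → CT C ≡ capT C
  CT≡capT C = sum-allFin (λ j → C (tv j) / 2)

  pebbleFreeS≡freeS : (C : Config s t) → pebbleFreeS C ≡ freeS C
  pebbleFreeS≡freeS C =
    trans (count-zeros (λ i → C (sv i)) (allFin s)) (sum-allFin (λ i → isZero (C (sv i))))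

module _ {s t : ℕ} where

  private
    encode : V s t → Maybe (Fin s ⊎ Fin t)
    encode root   = nothing
    encode (sv i) = just (inj₁ i)
    encode (tv j) = just (inj₂ j)

    decode : Maybe (Fin s ⊎ Fin t) → V s t
    decode nothing         = root
    decode (just (inj₁ i)) = sv i
    decode (just (inj₂ j)) = tv j

    decode-encode : ∀ w → decode (encode w) ≡ w
    decode-encode root   = refl
    decode-encode (sv i) = refl
    decode-encode (tv j) = refl

  _≟V_ : (a b : V s t) → Dec (a ≡ b)
  a ≟V b = map′ injective (cong encode)
    (Maybe.≡-dec (Sum.≡-dec _≟F_ _≟F_) (encode a) (encode b))
    where
    injective : encode a ≡ encode b → a ≡ b
    injective e = trans (sym (decode-encode a)) (trans (cong decode e) (decode-encode b))

  tv-injective : ∀ {j j' : Fin t} → tv {s} j ≡ tv j' → j ≡ j'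
  tv-injective refl = refl

  sv-injective : ∀ {i i' : Fin s} → sv {t = t} i ≡ sv i' → i ≡ i'
  sv-injective refl = refl

  -- The configuration after pebbling from u to v; it realises Result when
  -- the move is legal, so Defender can actually make the moves she chooses.
  afterMove : Config s t → V s t → V s t → Config s t
  afterMove C u v w with w ≟V u | w ≟V v
  ... | yes _ | _     = C u ∸ 2
  ... | no _  | yes _ = suc (C v)
  ... | no _  | no _  = C w

  afterMove-result : (C : Config s t) {u v : V s t} → u ≢ v → 2 ≤ C u →
    Result C u v (afterMove C u v)
  afterMove-result C {u} {v} u≢v two = source , target , elsewhere
    where
    source : afterMove C u v u + 2 ≡ C u
    source with u ≟V u
    ... | yes _   = m∸n+n≡m two
    ... | no u≢u  = contradiction refl u≢u
    target : afterMove C u v v ≡ suc (C v)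
    target with v ≟V u | v ≟V v
    ... | yes v≡u | _       = contradiction (sym v≡u) u≢v
    ... | no _    | yes _   = refl
    ... | no _    | no v≢v  = contradiction refl v≢v
    elsewhere : ∀ w → w ≢ u → w ≢ v → afterMove C u v w ≡ C w
    elsewhere w w≢u w≢v with w ≟V u | w ≟V v
    ... | yes w≡u | _       = contradiction w≡u w≢u
    ... | no _    | yes w≡v = contradiction w≡v w≢v
    ... | no _    | no _    = refl

  FixesAllBut : Config s t → Config s t → Fin t → Fin s → Set
  FixesAllBut C C' j i = ∀ w → w ≢ tv j → w ≢ sv i → C' w ≡ C w

  TS-fixes : ∀ {C C' j i} → Result C (tv j) (sv i) C' → FixesAllBut C C' j i
  TS-fixes (_ , _ , fixed) = fixed

  ST-fixes : ∀ {C C' j i} → Result C (sv i) (tv j) C' → FixesAllBut C C' j i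
  ST-fixes (_ , _ , fixed) w w≢tv w≢sv = fixed w w≢sv w≢tv

  root-same : ∀ {C C' j i} → FixesAllBut C C' j i → C' root ≡ C root
  root-same fixed = fixed root (λ ()) (λ ())

  T-same : ∀ {C C' j i} → FixesAllBut C C' j i → ∀ j' → j' ≢ j → C' (tv j') ≡ C (tv j')
  T-same fixed j' j'≢j = fixed (tv j') (j'≢j ∘ tv-injective) (λ ())

  S-same : ∀ {C C' j i} → FixesAllBut C C' j i → ∀ i' → i' ≢ i → C' (sv i') ≡ C (sv i')
  S-same fixed i' i'≢i = fixed (sv i') (λ ()) (i'≢i ∘ sv-injective)

half-plus-two : ∀ x → (2 + x) / 2 ≡ 1 + x / 2
half-plus-two x = m/n≡1+[m∸n]/n (s≤s (s≤s (z≤n {x})))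

module _ {s t : ℕ} {C C' : Config s t} {j : Fin t} {i : Fin s} where

  tPebbles-TS : Result C (tv j) (sv i) C' → tPebbles C ≡ 2 + tPebbles C'
  tPebbles-TS res@(lost , _ , _) =
    sum-raiseAt (λ x → C' (tv x)) (λ x → C (tv x)) j (T-same (TS-fixes res))
      2 (trans (sym lost) (+-comm _ 2))

  capT-TS : Result C (tv j) (sv i) C' → capT C ≡ 1 + capT C'
  capT-TS res@(lost , _ , _) =
    sum-raiseAt (λ x → C' (tv x) / 2) (λ x → C (tv x) / 2) j
      (λ j' j'≢j → cong (_/ 2) (T-same (TS-fixes res) j' j'≢j))
      1 (trans (cong (_/ 2) (trans (sym lost) (+-comm _ 2))) (half-plus-two (C' (tv j))))

  freeS-TS : Result C (tv j) (sv i) C' → freeS C ≡ isZero (C (sv i)) + freeS C'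
  freeS-TS res@(_ , gained , _) =
    sum-raiseAt (λ x → isZero (C' (sv x))) (λ x → isZero (C (sv x))) i
      (λ i' i'≢i → cong isZero (S-same (TS-fixes res) i' i'≢i))
      (isZero (C (sv i)))
      (sym (trans (cong (λ x → isZero (C (sv i)) + isZero x) gained) (+-identityʳ _)))

  tPebbles-ST : Result C (sv i) (tv j) C' → tPebbles C' ≡ 1 + tPebbles C
  tPebbles-ST res@(_ , gained , _) =
    sum-raiseAt (λ x → C (tv x)) (λ x → C' (tv x)) j
      (λ j' j'≢j → sym (T-same (ST-fixes res) j' j'≢j)) 1 gained

  capT-ST : Result C (sv i) (tv j) C' → capT C' ≤ 1 + capT C
  capT-ST res@(_ , gained , _) =
    sum-boundAt (λ x → C (tv x) / 2) (λ x → C' (tv x) / 2) j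
      (λ j' j'≢j → cong (_/ 2) (sym (T-same (ST-fixes res) j' j'≢j))) 1 half-bound
    where
    open ≤-Reasoning
    half-bound : C' (tv j) / 2 ≤ 1 + C (tv j) / 2
    half-bound = begin
      C' (tv j) / 2        ≡⟨ cong (_/ 2) gained ⟩
      (1 + C (tv j)) / 2   ≤⟨ /-monoˡ-≤ 2 (n≤1+n (1 + C (tv j))) ⟩
      (2 + C (tv j)) / 2   ≡⟨ half-plus-two (C (tv j)) ⟩
      1 + C (tv j) / 2     ∎

  freeS-ST : Result C (sv i) (tv j) C' → C (sv i) ≡ 2 → freeS C' ≡ 1 + freeS C
  freeS-ST res@(lost , _ , _) two =
    sum-raiseAt (λ x → isZero (C (sv x))) (λ x → isZero (C' (sv x))) i
      (λ i' i'≢i → cong isZero (sym (S-same (ST-fixes res) i' i'≢i)))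
      1 (trans (cong isZero emptied) (sym (cong (λ x → 1 + isZero x) two)))
    where
    emptied : C' (sv i) ≡ 0
    emptied = +-cancelʳ-≡ 2 (C' (sv i)) 0 (trans lost two)

module _ {s t : ℕ} where

  record AtMostOneOnS (C : Config s t) : Set where
    constructor atMostOne
    field pebbles≤1 : ∀ i → C (sv i) ≤ 1
  open AtMostOneOnS public

  record Safe (C : Config s t) : Set where
    field
      rootEmpty    : C root ≡ 0
      atMostOneOnS : AtMostOneOnS C
      bound        : capT C + freeS C % 2 ≤ 1 + freeS C

  atMostOne-update : ∀ {C C' : Config s t} {i} → AtMostOneOnS C →
    (∀ i' → i' ≢ i → C' (sv i') ≡ C (sv i')) → C' (sv i) ≤ 1 → AtMostOneOnS C'
  atMostOne-update {C' = C'} {i} (atMostOne low) same low-i = atMostOne bounded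
    where
    bounded : ∀ i' → C' (sv i') ≤ 1
    bounded i' with i' ≟F i
    ... | yes refl = low-i
    ... | no i'≢i  = subst (_≤ 1) (sym (same i' i'≢i)) (low i')

  atMostOne-fill : ∀ {C C' : Config s t} {j i} → AtMostOneOnS C →
    Result C (tv j) (sv i) C' → C (sv i) ≡ 0 → AtMostOneOnS C'
  atMostOne-fill low res@(_ , gained , _) empty =
    atMostOne-update low (S-same (TS-fixes res)) (≤-reflexive (trans gained (cong suc empty)))

  moves-from-T : ∀ {H : SimpleGraph s} {C : Config s t} {u v} → C root ≡ 0 →
    AtMostOneOnS C → Legal H C u v → ∃₂ λ j i → (u ≡ tv j) × (v ≡ sv i)
  moves-from-T empty _ (Edge.r-S _ , two) =
    contradiction two (≤⇒≯ (≤-trans (≤-reflexive empty) z≤n))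
  moves-from-T _ (atMostOne low) (Edge.S-r i , two)     = contradiction two (≤⇒≯ (low i))
  moves-from-T _ (atMostOne low) (Edge.S-T i _ , two)   = contradiction two (≤⇒≯ (low i))
  moves-from-T _ (atMostOne low) (Edge.S-S {i} _ , two) = contradiction two (≤⇒≯ (low i))
  moves-from-T _ _ (Edge.T-S j i , _)                   = j , i , refl , refl

  no-legal-move : ∀ {H : SimpleGraph s} {C : Config s t} {u v} → C root ≡ 0 →
    AtMostOneOnS C → (∀ j → ¬ 2 ≤ C (tv j)) → ¬ Legal H C u v
  no-legal-move empty low stuck legal with moves-from-T empty low legal
  ... | j , _ , refl , refl = stuck j (proj₂ legal)

-- Initially k is even, so the bound is the hypothesis C_T ≤ k + 1.
initial-bound : ∀ {c k} → 2 ∣ k → c ≤ k + 1 → c + k % 2 ≤ 1 + k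
initial-bound {c} (divides q refl) c≤k+1 = begin
  c + q * 2 % 2  ≡⟨ cong (c +_) (m*n%n≡0 q 2) ⟩
  c + 0          ≡⟨ +-identityʳ c ⟩
  c              ≤⟨ c≤k+1 ⟩
  q * 2 + 1      ≡⟨ +-comm (q * 2) 1 ⟩
  1 + q * 2      ∎
  where open ≤-Reasoning

free-after-fill : ∀ {c c1 k k1} → c ≡ 1 + c1 → k ≡ 1 + k1 → 1 ≤ c1 →
  c + k % 2 ≤ 1 + k → 1 ≤ k1
free-after-fill {c1 = suc c'} {k1 = zero} refl refl _ (s≤s (s≤s c'+1≤0)) =
  contradiction (≤-trans (m≤n+m 1 c') c'+1≤0) λ ()
free-after-fill {k1 = suc _} _ _ _ _ = s≤s z≤n

-- Two fills lower c and k by two each; k keeps its parity.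
bound-after-fills : ∀ {c c1 c2 k k1 k2} → c ≡ 1 + c1 → c1 ≡ 1 + c2 →
  k ≡ 1 + k1 → k1 ≡ 1 + k2 → c + k % 2 ≤ 1 + k → c2 + k2 % 2 ≤ 1 + k2
bound-after-fills refl refl refl refl bound = ≤-pred (≤-pred bound)

-- A fill of an occupied vertex followed by Defender's bounce: c does not grow,
-- k rises by one, and the parity term is at most one.
bound-after-bounce : ∀ {c c1 c2 k k1 k2} → c ≡ 1 + c1 → c2 ≤ 1 + c1 →
  k ≡ k1 → k2 ≡ 1 + k1 → c + k % 2 ≤ 1 + k → c2 + k2 % 2 ≤ 1 + k2
bound-after-bounce {c1 = c1} {c2} {k1 = k1} refl c2≤ refl refl bound = begin
  c2 + suc k1 % 2  ≤⟨ +-mono-≤ c2≤ (≤-pred (m%n<n (suc k1) 2)) ⟩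
  suc c1 + 1       ≤⟨ +-monoˡ-≤ 1 (m+n≤o⇒m≤o (suc c1) bound) ⟩
  suc k1 + 1       ≡⟨ +-comm (suc k1) 1 ⟩
  1 + suc k1       ∎
  where open ≤-Reasoning

fuel-after-fills : ∀ {n a a1 a2} → a ≡ 2 + a1 → a1 ≡ 2 + a2 → a < suc n → a2 < n
fuel-after-fills {a2 = a2} refl refl (s≤s a≤n) = ≤-trans (m≤n+m (suc a2) 3) a≤n

fuel-after-bounce : ∀ {n a a1 a2} → a2 ≡ 1 + a1 → a ≡ 2 + a1 → a < suc n → a2 < n
fuel-after-bounce refl refl (s≤s a≤n) = a≤n

module Strategy {s t : ℕ} (H : SimpleGraph s)
  (other : Fin t → Fin t) (other≢ : ∀ j → other j ≢ j) where

  WinsBelow : ℕ → Set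
  WinsBelow n = ∀ (C : Config s t) → tPebbles C < n → Safe C → DefWinsM H C

  -- Mover filled an empty S-vertex: Defender fills another one if some
  -- T-vertex can move (the bound provides an empty one), else she is stuck.
  answer-fill : ∀ {n C C1 j i} → WinsBelow n → tPebbles C < suc n → Safe C →
    Result C (tv j) (sv i) C1 → C (sv i) ≡ 0 → DefWinsD H C1 (tv j) (sv i)
  answer-fill {n} {C} {C1} {j} {i} winsBelow fuel safe res empty =
    reply (any? λ j' → 2 ≤? C1 (tv j'))
    where
    open Safe safe
    root1 : C1 root ≡ 0
    root1 = trans (root-same (TS-fixes res)) rootEmpty
    low1 : AtMostOneOnS C1
    low1 = atMostOne-fill atMostOneOnS res empty
    freeS1 : freeS C ≡ 1 + freeS C1
    freeS1 = trans (freeS-TS res) (cong (λ x → isZero x + freeS C1) empty)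

    fill-hole : ∀ j' → 2 ≤ C1 (tv j') → (∃ λ i' → C1 (sv i') ≡ 0) →
      DefWinsD H C1 (tv j) (sv i)
    fill-hole j' two (i' , empty') =
      defender-move (tv j') (sv i') C2 (Edge.T-S j' i' , two) (λ { (() , _) })
        res2 root2 (winsBelow C2 fuel2 safe2)
      where
      C2 : Config s t
      C2 = afterMove C1 (tv j') (sv i')
      res2 : Result C1 (tv j') (sv i') C2
      res2 = afterMove-result C1 (λ ()) two
      root2 : C2 root ≡ 0
      root2 = trans (root-same (TS-fixes res2)) root1
      freeS2 : freeS C1 ≡ 1 + freeS C2
      freeS2 = trans (freeS-TS res2) (cong (λ x → isZero x + freeS C2) empty')
      safe2 : Safe C2
      safe2 = record
        { rootEmpty    = root2
        ; atMostOneOnS = atMostOne-fill low1 res2 empty'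
        ; bound        = bound-after-fills (capT-TS res) (capT-TS res2) freeS1 freeS2 bound
        }
      fuel2 : tPebbles C2 < n
      fuel2 = fuel-after-fills (tPebbles-TS res) (tPebbles-TS res2) fuel

    reply : Dec (∃ λ j' → 2 ≤ C1 (tv j')) → DefWinsD H C1 (tv j) (sv i)
    reply (no none) = defender-stuck λ u v legal →
      ⊥-elim (no-legal-move root1 low1 (λ j' two → none (j' , two)) legal)
    reply (yes (j' , two)) = fill-hole j' two
      (zero-of-count (λ x → C1 (sv x)) (free-after-fill (capT-TS res) freeS1 capT1-positive bound))
      where
      capT1-positive : 1 ≤ capT C1
      capT1-positive = ≤-trans (/-monoˡ-≤ 2 two) (term≤sum (λ x → C1 (tv x) / 2) j')

  -- Mover put a second pebble on an S-vertex: Defender moves the pair on to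
  -- a T-vertex different from the one Mover used.
  answer-bounce : ∀ {n C C1 j i} → WinsBelow n → tPebbles C < suc n → Safe C →
    Result C (tv j) (sv i) C1 → C (sv i) ≡ 1 → DefWinsD H C1 (tv j) (sv i)
  answer-bounce {n} {C} {C1} {j} {i} winsBelow fuel safe res@(_ , gained , _) single =
    defender-move (sv i) (tv (other j)) C2 (Edge.S-T i (other j) , two) not-reverse
      res2 root2 (winsBelow C2 fuel2 safe2)
    where
    open Safe safe
    doubled : C1 (sv i) ≡ 2
    doubled = trans gained (cong suc single)
    two : 2 ≤ C1 (sv i)
    two = ≤-reflexive (sym doubled)
    not-reverse : ¬ (sv i ≡ sv i × tv (other j) ≡ tv j)
    not-reverse (_ , back) = other≢ j (tv-injective back)
    C2 : Config s t
    C2 = afterMove C1 (sv i) (tv (other j))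
    res2 : Result C1 (sv i) (tv (other j)) C2
    res2 = afterMove-result C1 (λ ()) two
    root2 : C2 root ≡ 0
    root2 = trans (root-same (ST-fixes res2)) (trans (root-same (TS-fixes res)) rootEmpty)
    emptied : C2 (sv i) ≡ 0
    emptied = +-cancelʳ-≡ 2 (C2 (sv i)) 0 (trans (proj₁ res2) doubled)
    low2 : AtMostOneOnS C2
    low2 = atMostOne-update atMostOneOnS
      (λ i' i'≢i → trans (S-same (ST-fixes res2) i' i'≢i) (S-same (TS-fixes res) i' i'≢i))
      (≤-trans (≤-reflexive emptied) z≤n)
    freeS1 : freeS C ≡ freeS C1
    freeS1 = trans (freeS-TS res) (cong (λ x → isZero x + freeS C1) single)
    safe2 : Safe C2
    safe2 = record
      { rootEmpty    = root2
      ; atMostOneOnS = low2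
      ; bound        = bound-after-bounce (capT-TS res) (capT-ST res2) freeS1
                         (freeS-ST res2 doubled) bound
      }
    fuel2 : tPebbles C2 < n
    fuel2 = fuel-after-bounce (tPebbles-ST res2) (tPebbles-TS res) fuel

  defender-wins : ∀ n → WinsBelow n
  defender-wins zero    C () safe
  defender-wins (suc n) C fuel safe = mover-turn respond
    where
    open Safe safe
    respond : ∀ u v → Legal H C u v → ∀ C1 → Result C u v C1 →
      (C1 root ≡ 0) × DefWinsD H C1 u v
    respond u v legal C1 res with moves-from-T rootEmpty atMostOneOnS legal
    ... | j , i , refl , refl =
      trans (root-same (TS-fixes res)) rootEmpty ,
      answer (m≤n⇒m<n∨m≡n (pebbles≤1 atMostOneOnS i))
      where
      answer : C (sv i) < 1 ⊎ C (sv i) ≡ 1 → DefWinsD H C1 (tv j) (sv i)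
      answer (inj₁ below-one) = answer-fill (defender-wins n) fuel safe res (n<1⇒n≡0 below-one)
      answer (inj₂ one)       = answer-bounce (defender-wins n) fuel safe res one

-- With t ≥ 2 every T-vertex has a different partner.
partner : ∀ {t'} → Fin (suc (suc t')) → Fin (suc (suc t'))
partner Fin.zero    = Fin.suc Fin.zero
partner (Fin.suc _) = Fin.zero

partner≢ : ∀ {t'} (j : Fin (suc (suc t'))) → partner j ≢ j
partner≢ Fin.zero    ()
partner≢ (Fin.suc _) ()

lemma3p7 : (s t : ℕ) → 1 ≤ s → 2 ≤ t → (H : SimpleGraph s) → (C : Config s t) →
    NonTrivial C → 2 ∣ pebbleFreeS C → CT C ≤ pebbleFreeS C + 1 →
    DefenderWins H C
lemma3p7 s (suc (suc t')) _ (s≤s (s≤s _)) H C (rootEmpty , oneEach) even capBound =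
  Strategy.defender-wins H partner partner≢ (suc (tPebbles C)) C ≤-refl safe
  where
  safe : Safe C
  safe = record
    { rootEmpty    = rootEmpty
    ; atMostOneOnS = atMostOne oneEach
    ; bound        = initial-bound (subst (2 ∣_) (pebbleFreeS≡freeS C) even)
                       (subst₂ _≤_ (CT≡capT C) (cong (_+ 1) (pebbleFreeS≡freeS C)) capBound)
    }
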